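{- Let $f$ be an upwards closed $n$-ary polymorphism of $(\mathbf{LO}_2,\mathbf{LO}_3)$. If $X,Y\subseteq[n]$ are disjoint non-empty boolean sets of $f$ with $X\cup Y=[n]$, then both $X$ and $Y$ are 2-recolourable.
   Context: $[n]=\{1,\dots,n\}$. $\mathrm{LO}_3\subseteq\{0,1,2\}^3$ is the set of triples whose maximum entry occurs in exactly one coordinate. Identify $X\subseteq[n]$ with the 0/1 tuple having 1 exactly in positions of $X$. $f:\{0,1\}^n\to\{0,1,2\}$ is a polymorphism of $(\mathbf{LO}_2,\mathbf{LO}_3)$ iff for every ordered partition $(X,Y,Z)$ of $[n]$ into three (possibly empty) parts, $(f(X),f(Y),f(Z))\in\mathrm{LO}_3$. $X$ is a 2-set if $f(X)=2$, a boolean set if $f(X)\in\{0,1\}$. $f$ is upwards closed if every superset of a 2-set is a 2-set. A set is 2-recolourable if changing the value of $f$ at that set alone to 2 still yields a polymorphism. -}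

module Defs where

open import Data.Nat using (ℕ)
open import Data.Bool using (Bool; true; false; _∧_; _∨_; not)
open import Data.Fin using (Fin; zero; suc)
open import Data.Fin.Properties using () renaming (_≟_ to _≟F_)
open import Data.Vec using (Vec; map; zipWith; replicate)
open import Data.Vec.Properties using (≡-dec)
open import Data.Bool.Properties using () renaming (_≟_ to _≟B_)
open import Data.Fin.Subset using (Subset; _⊆_; Empty; Nonempty; _∩_; _∪_; ⊥; ⊤)
open import Data.Product using (_×_; ∃)
open import Relation.Binary.PropositionalEquality using (_≡_; _≢_)
open import Relation.Nullary using (¬_; yes; no)

Val : Set
Val = Fin 3

two : Val
two = suc (suc zero)

maxV : Val → Val → Val
maxV zero y = y
maxV x zero = x
maxV (suc zero) y = y
maxV x (suc zero) = x
maxV (suc (suc zero)) (suc (suc zero)) = two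

-- LO₃: the maximum entry of the triple occurs in exactly one coordinate
-- (i.e. the maximum coordinate is unique).
data LO₃ : Val → Val → Val → Set where
  first  : ∀ {a b c} → a ≡ maxV a (maxV b c) → b ≢ a → c ≢ a → LO₃ a b c
  second : ∀ {a b c} → b ≡ maxV a (maxV b c) → a ≢ b → c ≢ b → LO₃ a b c
  third  : ∀ {a b c} → c ≡ maxV a (maxV b c) → a ≢ c → b ≢ c → LO₃ a b c

-- n-ary functions {0,1}^n → {0,1,2}; subsets of [n] are 0/1 tuples (Subset n = Vec Bool n).
Fun : ℕ → Set
Fun n = Subset n → Val

-- An ordered partition (X,Y,Z) of [n] is given by a colouring p : Vec (Fin 3) n;
-- part k of p is the set of positions coloured k.
part : ∀ {n} → Vec (Fin 3) n → Fin 3 → Subset n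
part p k = map (λ c → isYes (c ≟F k)) p
  where
    open import Relation.Nullary.Decidable using (isYes)

IsPolymorphism : ∀ {n} → Fun n → Set
IsPolymorphism {n} f = (p : Vec (Fin 3) n) →
  LO₃ (f (part p zero)) (f (part p (suc zero))) (f (part p two))

TwoSet : ∀ {n} → Fun n → Subset n → Set
TwoSet f X = f X ≡ two

BooleanSet : ∀ {n} → Fun n → Subset n → Set
BooleanSet f X = f X ≢ two

UpwardsClosed : ∀ {n} → Fun n → Set
UpwardsClosed {n} f = ∀ (X Y : Subset n) → X ⊆ Y → TwoSet f X → TwoSet f Y

recolour : ∀ {n} → Fun n → Subset n → Fun n
recolour f X S with ≡-dec _≟B_ S X
... | yes _ = two
... | no  _ = f S

TwoRecolourable : ∀ {n} → Fun n → Subset n → Set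
TwoRecolourable f X = IsPolymorphism (recolour f X)

-- If some part of a partition is X, the other two parts are disjoint from X, hence contained
-- in Y, hence boolean because Y is boolean and f is upwards closed; they are not X either,
-- as X is non-empty. So the recoloured triple is 2 at the part X and boolean elsewhere, which
-- lies in LO₃. If no part is X, the triple is unchanged. Recolouring X uses only that Y is
-- boolean.
module Submission where

open import Defs
open import Data.Nat using (ℕ)
open import Data.Product using (_×_; _,_)
open import Relation.Binary.PropositionalEquality using (_≡_)
open import Data.Fin.Subset using (Subset; Nonempty; Empty; _∩_; _∪_; ⊤)

open import Data.Bool.Properties using () renaming (_≟_ to _≟B_)
open import Data.Fin using (Fin; zero; suc)
open import Data.Fin.Properties using (any?) renaming (_≟_ to _≟F_)
open import Data.Fin.Subset using (_∈_; _∉_; _⊆_)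
open import Data.Fin.Subset.Properties using (∈⊤; x∈p∪q⁻; ∪-comm)
open import Data.Sum using (inj₁; inj₂)
open import Data.Vec using (Vec; lookup)
open import Data.Vec.Properties using (≡-dec; lookup-map; []=⇒lookup)
open import Relation.Binary.PropositionalEquality using (_≢_; refl; sym; trans; cong; subst)
open import Relation.Nullary using (yes; no; contradiction)
open import Relation.Binary.Definitions using (DecidableEquality)

maxV-twoˡ : ∀ v → maxV two v ≡ two
maxV-twoˡ zero             = refl
maxV-twoˡ (suc zero)       = refl
maxV-twoˡ (suc (suc zero)) = refl

maxV-twoʳ : ∀ v → maxV v two ≡ two
maxV-twoʳ zero             = refl
maxV-twoʳ (suc zero)       = refl
maxV-twoʳ (suc (suc zero)) = refl

LO₃-two₁ : ∀ {a b c} → a ≡ two → b ≢ two → c ≢ two → LO₃ a b c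
LO₃-two₁ {b = b} {c} refl = first (sym (maxV-twoˡ (maxV b c)))

LO₃-two₂ : ∀ {a b c} → b ≡ two → a ≢ two → c ≢ two → LO₃ a b c
LO₃-two₂ {a = a} {c = c} refl =
  second (sym (trans (cong (maxV a) (maxV-twoˡ c)) (maxV-twoʳ a)))

LO₃-two₃ : ∀ {a b c} → c ≡ two → a ≢ two → b ≢ two → LO₃ a b c
LO₃-two₃ {a = a} {b} refl =
  third (sym (trans (cong (maxV a) (maxV-twoʳ b)) (maxV-twoʳ a)))

LO₃-resp : ∀ {a b c a′ b′ c′} → a ≡ a′ → b ≡ b′ → c ≡ c′ → LO₃ a b c → LO₃ a′ b′ c′
LO₃-resp refl refl refl t = t

recolour-≡ : ∀ {n} (f : Fun n) {X S : Subset n} → S ≡ X → recolour f X S ≡ two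
recolour-≡ f {X} {S} S≡X with ≡-dec _≟B_ S X
... | yes _   = refl
... | no  S≢X = contradiction S≡X S≢X

recolour-≢ : ∀ {n} (f : Fun n) {X S : Subset n} → S ≢ X → recolour f X S ≡ f S
recolour-≢ f {X} {S} S≢X with ≡-dec _≟B_ S X
... | yes S≡X = contradiction S≡X S≢X
... | no  _   = refl

∈-part⁻ : ∀ {n} (p : Vec (Fin 3) n) {k i} → i ∈ part p k → lookup p i ≡ k
∈-part⁻ p {k} {i} i∈
  with lookup p i ≟F k | trans (sym (lookup-map i _ p)) ([]=⇒lookup i∈)
... | yes pᵢ≡k | _  = pᵢ≡k
... | no  _    | ()

part-disjoint : ∀ {n} (p : Vec (Fin 3) n) {k k′ i} → k ≢ k′ →
                i ∈ part p k → i ∉ part p k′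
part-disjoint p k≢k′ i∈k i∈k′ = k≢k′ (trans (sym (∈-part⁻ p i∈k)) (∈-part⁻ p i∈k′))

∪≡⊤⇒∉ˡ⇒∈ʳ : ∀ {n} {X Y : Subset n} → X ∪ Y ≡ ⊤ → ∀ {i} → i ∉ X → i ∈ Y
∪≡⊤⇒∉ˡ⇒∈ʳ {X = X} {Y} X∪Y≡⊤ i∉X with x∈p∪q⁻ X Y (subst (_ ∈_) (sym X∪Y≡⊤) ∈⊤)
... | inj₁ i∈X = contradiction i∈X i∉X
... | inj₂ i∈Y = i∈Y

_≟ₛ_ : ∀ {n} → DecidableEquality (Subset n)
_≟ₛ_ = ≡-dec _≟B_

module _ {n} (f : Fun n) (poly : IsPolymorphism f) (up : UpwardsClosed f)
         (X Y : Subset n) (X≢∅ : Nonempty X) (∉X⇒∈Y : ∀ {i} → i ∉ X → i ∈ Y)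
         (boolY : BooleanSet f Y) where

  recolour-otherPart≢two : (p : Vec (Fin 3) n) {k k′ : Fin 3} → part p k ≡ X → k ≢ k′ →
                           recolour f X (part p k′) ≢ two
  recolour-otherPart≢two p {k} {k′} refl k≢k′ =
    subst (_≢ two) (sym (recolour-≢ f part≢X)) (λ two-set → boolY (up _ Y part⊆Y two-set))
    where
      part≢X : part p k′ ≢ part p k
      part≢X eq = let i , i∈X = X≢∅ in
        part-disjoint p k≢k′ i∈X (subst (_ ∈_) (sym eq) i∈X)

      part⊆Y : part p k′ ⊆ Y
      part⊆Y i∈k′ = ∉X⇒∈Y (λ i∈k → part-disjoint p k≢k′ i∈k i∈k′)

  twoRecolourable : TwoRecolourable f X
  twoRecolourable p with any? (λ k → part p k ≟ₛ X)
  ... | yes (zero , e) =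
    LO₃-two₁ (recolour-≡ f e) (recolour-otherPart≢two p e (λ ())) (recolour-otherPart≢two p e (λ ()))
  ... | yes (suc zero , e) =
    LO₃-two₂ (recolour-≡ f e) (recolour-otherPart≢two p e (λ ())) (recolour-otherPart≢two p e (λ ()))
  ... | yes (suc (suc zero) , e) =
    LO₃-two₃ (recolour-≡ f e) (recolour-otherPart≢two p e (λ ())) (recolour-otherPart≢two p e (λ ()))
  ... | no noPartIsX =
    LO₃-resp (unchanged zero) (unchanged (suc zero)) (unchanged two) (poly p)
    where
      unchanged : ∀ k → f (part p k) ≡ recolour f X (part p k)
      unchanged k = sym (recolour-≢ f (λ e → noPartIsX (k , e)))

mainTheorem7 : (n : ℕ) (f : Fun n) → IsPolymorphism f → UpwardsClosed f →
    (X Y : Subset n) → Nonempty X → Nonempty Y → Empty (X ∩ Y) → X ∪ Y ≡ ⊤ →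
    BooleanSet f X → BooleanSet f Y →
    TwoRecolourable f X × TwoRecolourable f Y
mainTheorem7 n f poly up X Y X≢∅ Y≢∅ _ X∪Y≡⊤ boolX boolY =
  twoRecolourable f poly up X Y X≢∅ (∪≡⊤⇒∉ˡ⇒∈ʳ X∪Y≡⊤) boolY ,
  twoRecolourable f poly up Y X Y≢∅ (∪≡⊤⇒∉ˡ⇒∈ʳ (trans (∪-comm Y X) X∪Y≡⊤)) boolX
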